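{- Let $G$ be a finite group with identity $e$ and $S\subseteq G$ with $|S|\ge2$, and let $MX^*$ denote either $MX$ or $MX^+$ (the same choice throughout). Then: (a) $MX^*(G;S,\{e\})$ and $MX^*(G;S,S)$ are not isospectral; (b) $MX^*(G;S,\{e\})$ and $MX^*(G;S,S\cup\{e\})$ are not isospectral; (c) if $e\notin S$, then $MX^*(G;S,S)$ and $MX^*(G;S,S\cup\{e\})$ are not isospectral.
   Context: For $S,T\subseteq G$, $MX(G;S,T)$ has vertex set $G\times\mathbb{Z}_2$ and a directed edge $(h,i)\to(g,j)$ iff ($j=i$ and $gh^{ -1}\in S$) or ($j=i+1$ and $gh^{ -1}\in T$); $MX^+(G;S,T)$ is defined likewise with $gh$ in place of $gh^{ -1}$. Two graphs are isospectral if their $0/1$ adjacency matrices (loops giving diagonal $1$'s) have the same multiset of eigenvalues counted with algebraic multiplicity. -}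

module Defs where

open import Level using (0ℓ)
open import Data.Bool using (Bool; true; false; if_then_else_)
open import Data.Nat as ℕ using (ℕ; zero; suc)
open import Data.Integer as ℤ using (ℤ; +_)
open import Data.List using (List; []; _∷_; map; foldr; allFin)
open import Data.Fin using (Fin; zero; suc; punchIn; remQuot; toℕ)
open import Data.Fin.Properties using (_≟_)
open import Data.Fin.Subset using (Subset)
open import Data.Vec using (lookup)
open import Data.Product using (_×_; _,_)
open import Relation.Nullary using (does)
open import Relation.Binary.PropositionalEquality using (_≡_)
open import Algebra.Structures using (IsGroup)

-- Finite groups: a group structure on Fin n (every finite group of
-- order n is isomorphic to one of these), with propositional equality.

record FinGroup (n : ℕ) : Set where
  infixl 7 _∙_
  field
    _∙_     : Fin n → Fin n → Fin n
    ε       : Fin n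
    _⁻¹     : Fin n → Fin n
    isGroup : IsGroup _≡_ _∙_ ε _⁻¹

-- Integer polynomials as coefficient lists (constant term first).

Poly : Set
Poly = List ℤ

infixl 6 _+ᴾ_
infixl 7 _*ᴾ_

_+ᴾ_ : Poly → Poly → Poly
[]      +ᴾ q       = q
(a ∷ p) +ᴾ []      = a ∷ p
(a ∷ p) +ᴾ (b ∷ q) = (a ℤ.+ b) ∷ (p +ᴾ q)

scaleᴾ : ℤ → Poly → Poly
scaleᴾ a = map (a ℤ.*_)

_*ᴾ_ : Poly → Poly → Poly
[]      *ᴾ q = []
(a ∷ p) *ᴾ q = scaleᴾ a q +ᴾ ((+ 0) ∷ (p *ᴾ q))

coeff : Poly → ℕ → ℤ
coeff []      _       = + 0
coeff (a ∷ p) zero    = a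
coeff (a ∷ p) (suc k) = coeff p k

alt : ℕ → ℤ
alt zero    = + 1
alt (suc k) = ℤ.- alt k

det : ∀ {m} → (Fin m → Fin m → Poly) → Poly
det {zero}  M = (+ 1) ∷ []
det {suc m} M =
  foldr _+ᴾ_ []
    (map (λ j → scaleᴾ (alt (toℕ j))
                  (M zero j *ᴾ det (λ i k → M (suc i) (punchIn j k))))
         (allFin (suc m)))

charPoly : ∀ {m} → (Fin m → Fin m → ℤ) → Poly
charPoly A = det (λ i j →
  (if does (i ≟ j) then (+ 0) ∷ (+ 1) ∷ [] else []) +ᴾ (ℤ.- A i j ∷ []))

-- Two graphs (given by their 0/1 adjacency matrices, loops = diagonal
-- 1's) are isospectral iff their characteristic polynomials coincide,
-- i.e. they have the same eigenvalues with algebraic multiplicity.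
Isospectral : ∀ {m} → (Fin m → Fin m → ℤ) → (Fin m → Fin m → ℤ) → Set
Isospectral A B = ∀ k → coeff (charPoly A) k ≡ coeff (charPoly B) k

data Kind : Set where
  minus : Kind   -- MX  : uses g h⁻¹
  plus  : Kind   -- MX⁺ : uses g h

module _ {n : ℕ} (G : FinGroup n) where
  open FinGroup G

  -- directed edge (h,i) → (g,j), with i,j ∈ ℤ₂ = Fin 2
  -- (for Fin 2, j ≠ i is the same as j = i + 1)
  MXEdge : Kind → Subset n → Subset n → Fin 2 × Fin n → Fin 2 × Fin n → Bool
  MXEdge k S T (i , h) (j , g) =
    let x = elem k in
    if does (i ≟ j) then lookup S x else lookup T x
    where
      elem : Kind → Fin n
      elem minus = g ∙ (h ⁻¹)
      elem plus  = g ∙ h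

  -- adjacency matrix, vertices G × ℤ₂ enumerated as Fin (2 * n)
  MX : Kind → Subset n → Subset n → Fin (2 ℕ.* n) → Fin (2 ℕ.* n) → ℤ
  MX k S T u v =
    if MXEdge k S T (remQuot {2} n u) (remQuot {2} n v) then + 1 else + 0

{-# OPTIONS --safe #-}
module Submission where

-- Every vertex of MX*(G;S,T) has out-degree |S| + |T|, because g ↦ g c is a bijection of G.
-- So the two adjacency matrices A, B to be compared have constant row sums r < s, and s
-- separates their characteristic polynomials: the rows of sI − B sum to zero, so
-- det (sI − B) = 0, while sI − A has nonpositive off-diagonal entries and positive row sums.
-- Such a matrix M of size m + 1 has positive determinant by induction on m, via Chiò's
-- condensation  a^m det M = a det (a M_ij − M_i0 M_0j)_{i,j ≥ 1}  with pivot a = M_00 > 0,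
-- whose condensed matrix again has both properties.  The degrees differ in (a)–(c) because
-- |{e}| = 1 < |S| ≤ |S ∪ {e}|, and |S| < |S ∪ {e}| when e ∉ S.

open import Defs
open import Data.Nat using (ℕ; _≤_)
open import Data.Fin.Subset using (Subset; ∣_∣; ⁅_⁆; _∪_; _∉_)
open import Data.Product using (_×_)
open import Relation.Nullary using (¬_)

open import Algebra.Bundles using (Group)
open import Data.Bool using (Bool; true; false; if_then_else_)
open import Data.Fin as Fin using (Fin; zero; suc; toℕ; punchIn; punchOut; inject₁; _↑ˡ_; _↑ʳ_; combine; remQuot)
open import Data.Fin.Induction using (<-weakInduction)
open import Data.Fin.Permutation using (permutation)
open import Data.Fin.Properties
  using (_≟_; <-cmp; suc-injective; toℕ-injective; toℕ-inject₁; punchInᵢ≢i; punchIn-punchOut; punchOut-punchIn; remQuot-combine)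
open import Data.Fin.Subset.Properties using (∣⁅x⁆∣≡1; ∣p∣≤∣p∪q∣; p⊂q⇒∣p∣<∣q∣; p⊆p∪q; q⊆p∪q; x∈⁅x⁆)
open import Data.Integer as ℤ using (ℤ; +_; 0ℤ; 1ℤ; _+_; _*_; -_; _-_; _^_; +≤+; +<+)
open import Data.Integer.Properties as ℤ
  using (+-identityˡ; +-identityʳ; *-identityˡ; *-zeroʳ; neg-involutive; neg-distrib-+; neg-distribˡ-*)
open import Data.Integer.Tactic.RingSolver using (solve-∀)
open import Algebra.Properties.Semiring.Sum ℤ.+-*-semiring
  using (sum; sum-syntax; sum-cong-≗; ∑-distrib-+; *-distribˡ-sum; *-distribʳ-sum; sum-permute; sum-replicate-zero)
open import Data.List using ([]; _∷_; foldr; tabulate)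
open import Data.List.Properties using (map-tabulate)
open import Data.Nat as ℕ using (zero; suc; z≤n; s≤s)
import Data.Nat.Properties as ℕ
open import Data.Product using (_,_; ∃-syntax; proj₁; proj₂)
open import Data.Sum using (_⊎_; inj₁; inj₂)
open import Data.Vec using ([]; _∷_; lookup)
open import Function using (_∘_; id)
open import Function.Definitions using (Injective)
open import Level using (0ℓ)
open import Relation.Binary.Definitions using (tri<; tri≈; tri>)
open import Relation.Binary.PropositionalEquality
open import Relation.Nullary using (does; yes; no; contradiction)
open import Relation.Nullary.Decidable using (dec-true; dec-false)
open ≡-Reasoning

sum-neg : ∀ {n} (f : Fin n → ℤ) → ∑[ j < n ] (- f j) ≡ - sum f
sum-neg {zero}  f = refl
sum-neg {suc n} f = trans (cong (λ t → - f zero + t) (sum-neg (f ∘ suc))) (sym (neg-distrib-+ (f zero) _))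

sum-nonPos : ∀ {n} (f : Fin n → ℤ) → (∀ j → f j ℤ.≤ 0ℤ) → sum f ℤ.≤ 0ℤ
sum-nonPos {zero}  f _   = ℤ.≤-refl
sum-nonPos {suc n} f f≤0 = ℤ.+-mono-≤ (f≤0 zero) (sum-nonPos (f ∘ suc) (f≤0 ∘ suc))

sum-δ : ∀ {m} (i : Fin m) x → ∑[ j < m ] (if does (i ≟ j) then x else 0ℤ) ≡ x
sum-δ {suc m} zero    x = trans (cong (λ t → x + t) (sum-replicate-zero m)) (+-identityʳ x)
sum-δ {suc m} (suc i) x = trans (+-identityˡ _) (sum-δ i x)

sum-splitAt : ∀ m {n} (f : Fin (m ℕ.+ n) → ℤ) → sum f ≡ ∑[ i < m ] f (i ↑ˡ n) + ∑[ j < n ] f (m ↑ʳ j)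
sum-splitAt zero    f = sym (+-identityˡ _)
sum-splitAt (suc m) f = trans (cong (λ t → f zero + t) (sum-splitAt m (f ∘ suc))) (sym (ℤ.+-assoc (f zero) _ _))

sum-combine : ∀ k n (f : Fin (k ℕ.* n) → ℤ) → ∑[ i < k ] ∑[ j < n ] f (combine i j) ≡ sum f
sum-combine zero    n f = refl
sum-combine (suc k) n f = trans (cong (λ t → ∑[ j < n ] f (j ↑ˡ k ℕ.* n) + t) (sum-combine k n (f ∘ (n ↑ʳ_))))
                                (sym (sum-splitAt n f))

eval : ℤ → Poly → ℤ
eval x []      = 0ℤ
eval x (a ∷ p) = a + x * eval x p

eval-+ᴾ : ∀ x p q → eval x (p +ᴾ q) ≡ eval x p + eval x q
eval-+ᴾ x []      q       = sym (+-identityˡ _)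
eval-+ᴾ x (a ∷ p) []      = sym (+-identityʳ _)
eval-+ᴾ x (a ∷ p) (b ∷ q) = begin
  a + b + x * eval x (p +ᴾ q)           ≡⟨ cong (λ t → a + b + x * t) (eval-+ᴾ x p q) ⟩
  a + b + x * (eval x p + eval x q)     ≡⟨ shuffle a b (eval x p) (eval x q) x ⟩
  a + x * eval x p + (b + x * eval x q) ∎
  where
  shuffle : ∀ a b u v x → a + b + x * (u + v) ≡ a + x * u + (b + x * v)
  shuffle = solve-∀

eval-scaleᴾ : ∀ x a p → eval x (scaleᴾ a p) ≡ a * eval x p
eval-scaleᴾ x a []      = sym (*-zeroʳ a)
eval-scaleᴾ x a (b ∷ p) = begin
  a * b + x * eval x (scaleᴾ a p) ≡⟨ cong (λ t → a * b + x * t) (eval-scaleᴾ x a p) ⟩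
  a * b + x * (a * eval x p)      ≡⟨ distrib a b (eval x p) x ⟩
  a * (b + x * eval x p)          ∎
  where
  distrib : ∀ a b u x → a * b + x * (a * u) ≡ a * (b + x * u)
  distrib = solve-∀

eval-*ᴾ : ∀ x p q → eval x (p *ᴾ q) ≡ eval x p * eval x q
eval-*ᴾ x []      q = refl
eval-*ᴾ x (a ∷ p) q = begin
  eval x (scaleᴾ a q +ᴾ (0ℤ ∷ p *ᴾ q))             ≡⟨ eval-+ᴾ x (scaleᴾ a q) (0ℤ ∷ p *ᴾ q) ⟩
  eval x (scaleᴾ a q) + (0ℤ + x * eval x (p *ᴾ q)) ≡⟨ cong₂ (λ s t → s + (0ℤ + x * t)) (eval-scaleᴾ x a q) (eval-*ᴾ x p q) ⟩
  a * eval x q + (0ℤ + x * (eval x p * eval x q))  ≡⟨ distrib a (eval x p) (eval x q) x ⟩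
  (a + x * eval x p) * eval x q                    ∎
  where
  distrib : ∀ a u v x → a * v + (0ℤ + x * (u * v)) ≡ (a + x * u) * v
  distrib = solve-∀

eval-foldr-tabulate : ∀ x {n} (q : Fin n → Poly) → eval x (foldr _+ᴾ_ [] (tabulate q)) ≡ ∑[ j < n ] eval x (q j)
eval-foldr-tabulate x {zero}  q = refl
eval-foldr-tabulate x {suc n} q = begin
  eval x (q zero +ᴾ foldr _+ᴾ_ [] (tabulate (q ∘ suc)))          ≡⟨ eval-+ᴾ x (q zero) _ ⟩
  eval x (q zero) + eval x (foldr _+ᴾ_ [] (tabulate (q ∘ suc))) ≡⟨ cong (λ t → eval x (q zero) + t) (eval-foldr-tabulate x (q ∘ suc)) ⟩
  eval x (q zero) + ∑[ j < n ] eval x (q (suc j))                ∎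

eval-coeffs≡0 : ∀ x q → (∀ k → coeff q k ≡ 0ℤ) → eval x q ≡ 0ℤ
eval-coeffs≡0 x []      _ = refl
eval-coeffs≡0 x (b ∷ q) e = begin
  b + x * eval x q ≡⟨ cong₂ (λ s t → s + x * t) (e 0) (eval-coeffs≡0 x q (e ∘ suc)) ⟩
  0ℤ + x * 0ℤ      ≡⟨ cong (λ t → 0ℤ + t) (*-zeroʳ x) ⟩
  0ℤ               ∎

eval-cong-coeff : ∀ x p q → (∀ k → coeff p k ≡ coeff q k) → eval x p ≡ eval x q
eval-cong-coeff x []      q       e = sym (eval-coeffs≡0 x q (sym ∘ e))
eval-cong-coeff x (a ∷ p) []      e = eval-coeffs≡0 x (a ∷ p) e
eval-cong-coeff x (a ∷ p) (b ∷ q) e = cong₂ (λ s t → s + x * t) (e 0) (eval-cong-coeff x p q (e ∘ suc))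

-- Determinants by Laplace expansion along the first row

Matrix : ℕ → Set
Matrix m = Fin m → Fin m → ℤ

minor : ∀ {A : Set} {m} → (Fin (suc m) → Fin (suc m) → A) → Fin (suc m) → Fin m → Fin m → A
minor M j i k = M (suc i) (punchIn j k)

detℤ : ∀ {m} → Matrix m → ℤ
detℤ {zero}  M = 1ℤ
detℤ {suc m} M = ∑[ j < suc m ] (alt (toℕ j) * (M zero j * detℤ (minor M j)))

laplaceTerm : ∀ {m} → Matrix (suc m) → Fin (suc m) → ℤ
laplaceTerm M j = alt (toℕ j) * (M zero j * detℤ (minor M j))

detℤ-cong : ∀ {m} {M N : Matrix m} → (∀ i j → M i j ≡ N i j) → detℤ M ≡ detℤ N
detℤ-cong {zero}  _ = refl
detℤ-cong {suc m} e = sum-cong-≗ λ j →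
  cong₂ (λ a d → alt (toℕ j) * (a * d)) (e zero j) (detℤ-cong λ i k → e (suc i) (punchIn j k))

eval-det : ∀ x {m} (M : Fin m → Fin m → Poly) → eval x (det M) ≡ detℤ (λ i j → eval x (M i j))
eval-det x {zero}  M = cong (λ t → 1ℤ + t) (*-zeroʳ x)
eval-det x {suc m} M = begin
  eval x (det M)                         ≡⟨ cong (eval x ∘ foldr _+ᴾ_ []) (map-tabulate id term) ⟩
  eval x (foldr _+ᴾ_ [] (tabulate term)) ≡⟨ eval-foldr-tabulate x term ⟩
  ∑[ j < suc m ] eval x (term j)         ≡⟨ sum-cong-≗ eval-term ⟩
  detℤ (λ i j → eval x (M i j))          ∎
  where
  term : Fin (suc m) → Poly
  term j = scaleᴾ (alt (toℕ j)) (M zero j *ᴾ det (minor M j))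
  eval-term : ∀ j → eval x (term j) ≡ laplaceTerm (λ i k → eval x (M i k)) j
  eval-term j = begin
    eval x (term j)
      ≡⟨ eval-scaleᴾ x (alt (toℕ j)) (M zero j *ᴾ det (minor M j)) ⟩
    alt (toℕ j) * eval x (M zero j *ᴾ det (minor M j))
      ≡⟨ cong (alt (toℕ j) *_) (eval-*ᴾ x (M zero j) (det (minor M j))) ⟩
    alt (toℕ j) * (eval x (M zero j) * eval x (det (minor M j)))
      ≡⟨ cong (λ d → alt (toℕ j) * (eval x (M zero j) * d)) (eval-det x (minor M j)) ⟩
    laplaceTerm (λ i k → eval x (M i k)) j
      ∎

charMatrix : ∀ {m} → ℤ → Matrix m → Matrix m
charMatrix x A i j = (if does (i ≟ j) then x else 0ℤ) - A i j

charMatrix-rowSum : ∀ {m} x (A : Matrix m) i → sum (charMatrix x A i) ≡ x - sum (A i)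
charMatrix-rowSum x A i = trans (∑-distrib-+ (λ j → if does (i ≟ j) then x else 0ℤ) (λ j → - A i j))
                                (cong₂ _+_ (sum-δ i x) (sum-neg (A i)))

eval-charPoly : ∀ x {m} (A : Matrix m) → eval x (charPoly A) ≡ detℤ (charMatrix x A)
eval-charPoly x A =
  trans (eval-det x (λ i j → (if does (i ≟ j) then 0ℤ ∷ 1ℤ ∷ [] else []) +ᴾ (- A i j ∷ [])))
        (detℤ-cong λ i j → eval-entry (does (i ≟ j)) (A i j))
  where
  eval-entry : ∀ b a → eval x ((if b then 0ℤ ∷ 1ℤ ∷ [] else []) +ᴾ (- a ∷ [])) ≡ (if b then x else 0ℤ) - a
  eval-entry true  a = diagonal x a
    where
    diagonal : ∀ x a → (0ℤ + - a) + x * (1ℤ + x * 0ℤ) ≡ x - a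
    diagonal = solve-∀
  eval-entry false a = offDiagonal x a
    where
    offDiagonal : ∀ x a → - a + x * 0ℤ ≡ 0ℤ - a
    offDiagonal = solve-∀

-- Column operations

AgreeOutside : ∀ {m} → Fin m → Matrix m → Matrix m → Set
AgreeOutside c M N = ∀ i j → j ≢ c → M i j ≡ N i j

punchIn≢ : ∀ {m} {j c : Fin (suc m)} (j≢c : j ≢ c) {k : Fin m} → k ≢ punchOut j≢c → punchIn j k ≢ c
punchIn≢ {j = j} j≢c k≢ refl = k≢ (sym (punchOut-punchIn j))

minor-≡ : ∀ {m} {c : Fin (suc m)} {M N} → AgreeOutside c M N → ∀ i k → minor M c i k ≡ minor N c i k
minor-≡ {c = c} M≈N i k = M≈N (suc i) (punchIn c k) (punchInᵢ≢i c k)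

minor-agreeOutside : ∀ {m} {c j : Fin (suc m)} {M N} (j≢c : j ≢ c) →
  AgreeOutside c M N → AgreeOutside (punchOut j≢c) (minor M j) (minor N j)
minor-agreeOutside {j = j} j≢c M≈N i k k≢ = M≈N (suc i) (punchIn j k) (punchIn≢ j≢c k≢)

det-linear-column : ∀ {m} (c : Fin m) (k l : ℤ) {M N P : Matrix m} →
  AgreeOutside c M N → AgreeOutside c M P → (∀ i → M i c ≡ k * N i c + l * P i c) →
  detℤ M ≡ k * detℤ N + l * detℤ P
det-linear-column {suc m} c k l {M} {N} {P} M≈N M≈P column = begin
  ∑[ j < suc m ] laplaceTerm M j
    ≡⟨ sum-cong-≗ split ⟩
  ∑[ j < suc m ] (k * laplaceTerm N j + l * laplaceTerm P j)
    ≡⟨ ∑-distrib-+ (λ j → k * laplaceTerm N j) (λ j → l * laplaceTerm P j) ⟩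
  ∑[ j < suc m ] (k * laplaceTerm N j) + ∑[ j < suc m ] (l * laplaceTerm P j)
    ≡˘⟨ cong₂ _+_ (*-distribˡ-sum k (laplaceTerm N)) (*-distribˡ-sum l (laplaceTerm P)) ⟩
  k * detℤ N + l * detℤ P
    ∎
  where
  split : ∀ j → laplaceTerm M j ≡ k * laplaceTerm N j + l * laplaceTerm P j
  split j with j ≟ c
  ... | yes refl = begin
    alt (toℕ j) * (M zero j * detℤ (minor M j))
      ≡⟨ cong₂ (λ a d → alt (toℕ j) * (a * d)) (column zero) (detℤ-cong (minor-≡ M≈N)) ⟩
    alt (toℕ j) * ((k * N zero j + l * P zero j) * detℤ (minor N j))
      ≡⟨ bilinear k l (alt (toℕ j)) (N zero j) (P zero j) (detℤ (minor N j)) ⟩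
    k * laplaceTerm N j + l * (alt (toℕ j) * (P zero j * detℤ (minor N j)))
      ≡⟨ cong (λ d → k * laplaceTerm N j + l * (alt (toℕ j) * (P zero j * d))) minor-N≡minor-P ⟩
    k * laplaceTerm N j + l * laplaceTerm P j
      ∎
    where
    minor-N≡minor-P : detℤ (minor N j) ≡ detℤ (minor P j)
    minor-N≡minor-P = trans (sym (detℤ-cong (minor-≡ M≈N))) (detℤ-cong (minor-≡ M≈P))
    bilinear : ∀ k l a x y d → a * ((k * x + l * y) * d) ≡ k * (a * (x * d)) + l * (a * (y * d))
    bilinear = solve-∀
  ... | no j≢c = begin
    alt (toℕ j) * (M zero j * detℤ (minor M j))
      ≡⟨ cong (λ d → alt (toℕ j) * (M zero j * d)) minor-linear ⟩
    alt (toℕ j) * (M zero j * (k * detℤ (minor N j) + l * detℤ (minor P j)))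
      ≡⟨ bilinear k l (alt (toℕ j)) (M zero j) (detℤ (minor N j)) (detℤ (minor P j)) ⟩
    k * (alt (toℕ j) * (M zero j * detℤ (minor N j))) + l * (alt (toℕ j) * (M zero j * detℤ (minor P j)))
      ≡⟨ cong₂ (λ a b → k * (alt (toℕ j) * (a * detℤ (minor N j))) + l * (alt (toℕ j) * (b * detℤ (minor P j))))
               (M≈N zero j j≢c) (M≈P zero j j≢c) ⟩
    k * laplaceTerm N j + l * laplaceTerm P j
      ∎
    where
    minor-linear : detℤ (minor M j) ≡ k * detℤ (minor N j) + l * detℤ (minor P j)
    minor-linear = det-linear-column (punchOut j≢c) k l (minor-agreeOutside j≢c M≈N) (minor-agreeOutside j≢c M≈P)
      (λ i → subst (λ t → M (suc i) t ≡ k * N (suc i) t + l * P (suc i) t) (sym (punchIn-punchOut j≢c)) (column (suc i)))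
    bilinear : ∀ k l a x d e → a * (x * (k * d + l * e)) ≡ k * (a * (x * d)) + l * (a * (x * e))
    bilinear = solve-∀

det-zero-column : ∀ {m} (M : Matrix m) (c : Fin m) → (∀ i → M i c ≡ 0ℤ) → detℤ M ≡ 0ℤ
det-zero-column M c zero-column = det-linear-column c 0ℤ 0ℤ (λ _ _ _ → refl) (λ _ _ _ → refl) zero-column

swap : ∀ {m} → Fin m → Fin (suc m) → Fin (suc m)
swap zero    zero          = suc zero
swap zero    (suc zero)    = zero
swap zero    (suc (suc j)) = suc (suc j)
swap (suc c) zero          = zero
swap (suc c) (suc j)       = suc (swap c j)

swap-involutive : ∀ {m} (c : Fin m) j → swap c (swap c j) ≡ j
swap-involutive zero    zero          = refl
swap-involutive zero    (suc zero)    = refl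
swap-involutive zero    (suc (suc j)) = refl
swap-involutive (suc c) zero          = refl
swap-involutive (suc c) (suc j)       = cong suc (swap-involutive c j)

swap-inject₁ : ∀ {m} (c : Fin m) → swap c (inject₁ c) ≡ suc c
swap-inject₁ zero    = refl
swap-inject₁ (suc c) = cong suc (swap-inject₁ c)

swap-below : ∀ {m} (c : Fin m) {j} → toℕ j ℕ.< toℕ c → swap c j ≡ j
swap-below (suc c) {zero}  _   = refl
swap-below (suc c) {suc j} j<c = cong suc (swap-below c (ℕ.s<s⁻¹ j<c))

swap-invariant : ∀ {A : Set} {m} (c : Fin m) (f : Fin (suc m) → A) →
  f (inject₁ c) ≡ f (suc c) → ∀ j → f (swap c j) ≡ f j
swap-invariant zero    f e zero          = sym e
swap-invariant zero    f e (suc zero)    = e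
swap-invariant zero    f e (suc (suc j)) = refl
swap-invariant (suc c) f e zero          = refl
swap-invariant (suc c) f e (suc j)       = swap-invariant c (f ∘ suc) e j

-- Deleting column  swap c j  after swapping deletes column j before it: exactly, with the
-- opposite sign, if j is one of the two swapped columns, and up to a swap of the minor otherwise.
swap-punchIn : ∀ {m} (c : Fin (suc m)) (j : Fin (suc (suc m))) →
    (alt (toℕ (swap c j)) ≡ - alt (toℕ j) × (∀ k → swap c (punchIn (swap c j) k) ≡ punchIn j k))
  ⊎ (swap c j ≡ j × ∃[ c′ ] (∀ k → swap c (punchIn j k) ≡ punchIn j (swap c′ k)))
swap-punchIn         zero    zero          = inj₁ (refl , λ { zero → refl ; (suc k) → refl })
swap-punchIn         zero    (suc zero)    = inj₁ (refl , λ { zero → refl ; (suc k) → refl })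
swap-punchIn {suc m} zero    (suc (suc j)) = inj₂ (refl , zero , λ { zero → refl ; (suc zero) → refl ; (suc (suc k)) → refl })
swap-punchIn         (suc c) zero          = inj₂ (refl , c , λ k → refl)
swap-punchIn {suc m} (suc c) (suc j) with swap-punchIn c j
... | inj₁ (alt-swap , e)   = inj₁ (cong -_ alt-swap , λ { zero → refl ; (suc k) → cong suc (e k) })
... | inj₂ (fixed , c′ , e) = inj₂ (cong suc fixed , suc c′ , λ { zero → refl ; (suc k) → cong suc (e k) })

det-swap-adjacent : ∀ {m} (M : Matrix (suc m)) (c : Fin m) → detℤ (λ i j → M i (swap c j)) ≡ - detℤ M
det-swap-adjacent {suc m} M c = begin
  ∑[ j < suc (suc m) ] laplaceTerm N j          ≡⟨ sum-permute (laplaceTerm N) (permutation (swap c) (swap c) (swap-involutive c) (swap-involutive c)) ⟩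
  ∑[ j < suc (suc m) ] laplaceTerm N (swap c j) ≡⟨ sum-cong-≗ swapped-term ⟩
  ∑[ j < suc (suc m) ] (- laplaceTerm M j)      ≡⟨ sum-neg (laplaceTerm M) ⟩
  - detℤ M                                      ∎
  where
  N : Matrix (suc (suc m))
  N i j = M i (swap c j)
  swapped-term : ∀ j → laplaceTerm N (swap c j) ≡ - laplaceTerm M j
  swapped-term j with swap-punchIn c j
  ... | inj₁ (alt-swap , e) = begin
    alt (toℕ (swap c j)) * (M zero (swap c (swap c j)) * detℤ (minor N (swap c j)))
      ≡⟨ cong₂ (λ s a → s * (M zero a * detℤ (minor N (swap c j)))) alt-swap (swap-involutive c j) ⟩
    - alt (toℕ j) * (M zero j * detℤ (minor N (swap c j)))
      ≡⟨ cong (λ d → - alt (toℕ j) * (M zero j * d)) (detℤ-cong λ i k → cong (M (suc i)) (e k)) ⟩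
    - alt (toℕ j) * (M zero j * detℤ (minor M j))
      ≡˘⟨ neg-distribˡ-* (alt (toℕ j)) _ ⟩
    - laplaceTerm M j
      ∎
  ... | inj₂ (fixed , c′ , e) = begin
    laplaceTerm N (swap c j)
      ≡⟨ cong (laplaceTerm N) fixed ⟩
    alt (toℕ j) * (M zero (swap c j) * detℤ (minor N j))
      ≡⟨ cong₂ (λ a d → alt (toℕ j) * (M zero a * d)) fixed minor-swapped ⟩
    alt (toℕ j) * (M zero j * - detℤ (minor M j))
      ≡⟨ negate (alt (toℕ j)) (M zero j) (detℤ (minor M j)) ⟩
    - laplaceTerm M j
      ∎
    where
    minor-swapped : detℤ (minor N j) ≡ - detℤ (minor M j)
    minor-swapped = trans (detℤ-cong λ i k → cong (M (suc i)) (e k)) (det-swap-adjacent (minor M j) c′)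
    negate : ∀ a x d → a * (x * - d) ≡ - (a * (x * d))
    negate = solve-∀

i≡-i⇒i≡0 : ∀ {i} → i ≡ - i → i ≡ 0ℤ
i≡-i⇒i≡0 {+ zero}     _ = refl
i≡-i⇒i≡0 {+ suc n}    ()
i≡-i⇒i≡0 {ℤ.-[1+ n ]} ()

-i≡0⇒i≡0 : ∀ {i} → - i ≡ 0ℤ → i ≡ 0ℤ
-i≡0⇒i≡0 {i} e = trans (sym (neg-involutive i)) (cong -_ e)

det-equal-adjacent-columns : ∀ {m} (M : Matrix (suc m)) (c : Fin m) →
  (∀ i → M i (inject₁ c) ≡ M i (suc c)) → detℤ M ≡ 0ℤ
det-equal-adjacent-columns M c e = i≡-i⇒i≡0 (begin
  detℤ M                        ≡˘⟨ detℤ-cong (λ i → swap-invariant c (M i) (e i)) ⟩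
  detℤ (λ i j → M i (swap c j)) ≡⟨ det-swap-adjacent M c ⟩
  - detℤ M                      ∎)

-- Swapping column b with its left neighbour moves the copy of column a one step closer to a.
det-equal-columns-< : ∀ {m} (b : Fin (suc m)) (M : Matrix (suc m)) {a} →
  a Fin.< b → (∀ i → M i a ≡ M i b) → detℤ M ≡ 0ℤ
det-equal-columns-< = <-weakInduction Singular (λ _ ()) step
  where
  Singular : Fin _ → Set
  Singular b = ∀ M {a} → a Fin.< b → (∀ i → M i a ≡ M i b) → detℤ M ≡ 0ℤ
  step : ∀ b → Singular (inject₁ b) → Singular (suc b)
  step b ih M {a} a<sb e with ℕ.m≤n⇒m<n∨m≡n (ℕ.s≤s⁻¹ a<sb)
  ... | inj₂ a≡b = det-equal-adjacent-columns M b λ i →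
    trans (cong (M i) (sym (toℕ-injective (trans a≡b (sym (toℕ-inject₁ b)))))) (e i)
  ... | inj₁ a<b = -i≡0⇒i≡0 (trans (sym (det-swap-adjacent M b)) (ih N a<inject₁b N-equal))
    where
    N : Matrix _
    N i j = M i (swap b j)
    a<inject₁b : a Fin.< inject₁ b
    a<inject₁b = subst (toℕ a ℕ.<_) (sym (toℕ-inject₁ b)) a<b
    N-equal : ∀ i → N i a ≡ N i (inject₁ b)
    N-equal i = begin
      M i (swap b a)           ≡⟨ cong (M i) (swap-below b a<b) ⟩
      M i a                    ≡⟨ e i ⟩
      M i (suc b)              ≡˘⟨ cong (M i) (swap-inject₁ b) ⟩
      M i (swap b (inject₁ b)) ∎

det-equal-columns : ∀ {m} (M : Matrix m) {a b : Fin m} → a ≢ b → (∀ i → M i a ≡ M i b) → detℤ M ≡ 0ℤ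
det-equal-columns {suc m} M {a} {b} a≢b e with <-cmp a b
... | tri< a<b _ _ = det-equal-columns-< b M a<b e
... | tri≈ _ a≡b _ = contradiction a≡b a≢b
... | tri> _ _ b<a = det-equal-columns-< a M b<a (sym ∘ e)

setColumn : ∀ {m} → Fin m → (Fin m → ℤ) → Matrix m → Matrix m
setColumn c v M i j = if does (j ≟ c) then v i else M i j

setColumn-≡ : ∀ {m} (c : Fin m) v M i → setColumn c v M i c ≡ v i
setColumn-≡ c v M i rewrite dec-true (c ≟ c) refl = refl

setColumn-≢ : ∀ {m} (c : Fin m) v M → AgreeOutside c (setColumn c v M) M
setColumn-≢ c v M i j j≢c rewrite dec-false (j ≟ c) j≢c = refl

setColumn-cong : ∀ {m} (c : Fin m) {v w M N} → (∀ i → v i ≡ w i) → AgreeOutside c M N →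
  ∀ i j → setColumn c v M i j ≡ setColumn c w N i j
setColumn-cong c v≡w M≈N i j with j ≟ c
... | yes refl = v≡w i
... | no j≢c   = M≈N i j j≢c

setColumn-id : ∀ {m} (c : Fin m) v M → (∀ i → v i ≡ M i c) → ∀ i j → setColumn c v M i j ≡ M i j
setColumn-id c v M v≡Mc i j with j ≟ c
... | yes refl = v≡Mc i
... | no _     = refl

det-add-column : ∀ {m} (M : Matrix m) (c d : Fin m) (k l : ℤ) → c ≢ d →
  detℤ (setColumn c (λ i → k * M i c + l * M i d) M) ≡ k * detℤ M
det-add-column M c d k l c≢d = begin
  detℤ P                  ≡⟨ det-linear-column c k l (setColumn-≢ c v M) P≈R column ⟩
  k * detℤ M + l * detℤ R ≡⟨ cong (λ t → k * detℤ M + l * t) R-singular ⟩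
  k * detℤ M + l * 0ℤ     ≡⟨ cong (λ t → k * detℤ M + t) (*-zeroʳ l) ⟩
  k * detℤ M + 0ℤ         ≡⟨ +-identityʳ _ ⟩
  k * detℤ M              ∎
  where
  v Md : Fin _ → ℤ
  v i = k * M i c + l * M i d
  Md i = M i d
  P R : Matrix _
  P = setColumn c v M
  R = setColumn c Md M
  P≈R : AgreeOutside c P R
  P≈R i j j≢c = trans (setColumn-≢ c v M i j j≢c) (sym (setColumn-≢ c Md M i j j≢c))
  column : ∀ i → P i c ≡ k * M i c + l * R i c
  column i = trans (setColumn-≡ c v M i) (cong (λ t → k * M i c + l * t) (sym (setColumn-≡ c Md M i)))
  R-singular : detℤ R ≡ 0ℤ
  R-singular = det-equal-columns R c≢d λ i → trans (setColumn-≡ c Md M i) (sym (setColumn-≢ c Md M i d (c≢d ∘ sym)))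

det-add-columns : ∀ {m n} (M : Matrix m) (c : Fin m) (f : Fin n → Fin m) → (∀ t → f t ≢ c) →
  detℤ (setColumn c (λ i → M i c + ∑[ t < n ] M i (f t)) M) ≡ detℤ M
det-add-columns {n = zero}  M c f _   = detℤ-cong (setColumn-id c _ M λ i → +-identityʳ (M i c))
det-add-columns {n = suc n} M c f f≢c = begin
  detℤ (setColumn c v M)                                      ≡⟨ detℤ-cong (setColumn-cong c v≡ M≈Q) ⟩
  detℤ (setColumn c (λ i → 1ℤ * Q i c + 1ℤ * Q i (f zero)) Q) ≡⟨ det-add-column Q c (f zero) 1ℤ 1ℤ (f≢c zero ∘ sym) ⟩
  1ℤ * detℤ Q                                                 ≡⟨ *-identityˡ _ ⟩
  detℤ Q                                                      ≡⟨ det-add-columns M c (f ∘ suc) (f≢c ∘ suc) ⟩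
  detℤ M                                                      ∎
  where
  u v : Fin _ → ℤ
  u i = M i c + ∑[ t < n ] M i (f (suc t))
  v i = M i c + ∑[ t < suc n ] M i (f t)
  Q : Matrix _
  Q = setColumn c u M
  M≈Q : AgreeOutside c M Q
  M≈Q i j j≢c = sym (setColumn-≢ c u M i j j≢c)
  v≡ : ∀ i → v i ≡ 1ℤ * Q i c + 1ℤ * Q i (f zero)
  v≡ i = begin
    M i c + (M i (f zero) + ∑[ t < n ] M i (f (suc t)))
      ≡⟨ regroup (M i c) (M i (f zero)) _ ⟩
    1ℤ * u i + 1ℤ * M i (f zero)
      ≡˘⟨ cong₂ (λ a b → 1ℤ * a + 1ℤ * b) (setColumn-≡ c u M i) (setColumn-≢ c u M i (f zero) (f≢c zero)) ⟩
    1ℤ * Q i c + 1ℤ * Q i (f zero)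
      ∎
    where
    regroup : ∀ a x s → a + (x + s) ≡ 1ℤ * (a + s) + 1ℤ * x
    regroup = solve-∀

det-zero-row-sums : ∀ {m} (M : Matrix (suc m)) → (∀ i → sum (M i) ≡ 0ℤ) → detℤ M ≡ 0ℤ
det-zero-row-sums M row-sums-zero = begin
  detℤ M                         ≡˘⟨ det-add-columns M zero suc (λ _ ()) ⟩
  detℤ (setColumn zero rowSum M) ≡⟨ det-zero-column (setColumn zero rowSum M) zero zero-column ⟩
  0ℤ                             ∎
  where
  rowSum : Fin _ → ℤ
  rowSum i = sum (M i)
  zero-column : ∀ i → setColumn zero rowSum M i zero ≡ 0ℤ
  zero-column i = trans (setColumn-≡ zero rowSum M i) (row-sums-zero i)

-- Chiò condensation and Z-matrices

tail≢head : ∀ {n m} (f : Fin (suc n) → Fin m) → Injective _≡_ _≡_ f → ∀ t → f (suc t) ≢ f zero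
tail≢head f f-inj t ft≡f0 with f-inj ft≡f0
... | ()

module _ {m} (M : Matrix (suc m)) where

  pivot : ℤ
  pivot = M zero zero

  eliminate : Matrix (suc m)
  eliminate i zero    = M i zero
  eliminate i (suc j) = pivot * M i (suc j) - M zero (suc j) * M i zero

  condense : Matrix m
  condense = minor eliminate zero

  eliminatedColumn : Fin m → Fin (suc m) → ℤ
  eliminatedColumn j i = eliminate i (suc j)

  eliminateColumns : ∀ {n} → (Fin n → Fin m) → Matrix (suc m)
  eliminateColumns {zero}  f = M
  eliminateColumns {suc n} f = setColumn (suc (f zero)) (eliminatedColumn (f zero)) (eliminateColumns (f ∘ suc))

  eliminateColumns-zero : ∀ {n} (f : Fin n → Fin m) i → eliminateColumns f i zero ≡ M i zero
  eliminateColumns-zero {zero}  f i = refl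
  eliminateColumns-zero {suc n} f i =
    trans (setColumn-≢ (suc (f zero)) (eliminatedColumn (f zero)) (eliminateColumns (f ∘ suc)) i zero (λ ()))
          (eliminateColumns-zero (f ∘ suc) i)

  eliminateColumns-untouched : ∀ {n} (f : Fin n → Fin m) {j} → (∀ t → f t ≢ j) →
    ∀ i → eliminateColumns f i (suc j) ≡ M i (suc j)
  eliminateColumns-untouched {zero}  f f≢j i = refl
  eliminateColumns-untouched {suc n} f f≢j i =
    trans (setColumn-≢ (suc (f zero)) (eliminatedColumn (f zero)) (eliminateColumns (f ∘ suc)) i _
                       (f≢j zero ∘ sym ∘ suc-injective))
          (eliminateColumns-untouched (f ∘ suc) (f≢j ∘ suc) i)

  eliminateColumns-touched : ∀ {n} (f : Fin n → Fin m) → Injective _≡_ _≡_ f →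
    ∀ t i → eliminateColumns f i (suc (f t)) ≡ eliminate i (suc (f t))
  eliminateColumns-touched {suc n} f f-inj zero    i =
    setColumn-≡ (suc (f zero)) (eliminatedColumn (f zero)) (eliminateColumns (f ∘ suc)) i
  eliminateColumns-touched {suc n} f f-inj (suc t) i =
    trans (setColumn-≢ (suc (f zero)) (eliminatedColumn (f zero)) (eliminateColumns (f ∘ suc)) i _
                       (tail≢head f f-inj t ∘ suc-injective))
          (eliminateColumns-touched (f ∘ suc) (suc-injective ∘ f-inj) t i)

  det-eliminateColumns : ∀ {n} (f : Fin n → Fin m) → Injective _≡_ _≡_ f →
    detℤ (eliminateColumns f) ≡ pivot ^ n * detℤ M
  det-eliminateColumns {zero}  f f-inj = sym (*-identityˡ _)
  det-eliminateColumns {suc n} f f-inj = begin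
    detℤ (setColumn c (eliminatedColumn (f zero)) Q)
      ≡⟨ detℤ-cong (setColumn-cong c {M = Q} {N = Q} column (λ _ _ _ → refl)) ⟩
    detℤ (setColumn c (λ i → pivot * Q i c + - M zero c * Q i zero) Q)
      ≡⟨ det-add-column Q c zero pivot (- M zero c) (λ ()) ⟩
    pivot * detℤ Q
      ≡⟨ cong (pivot *_) (det-eliminateColumns (f ∘ suc) (suc-injective ∘ f-inj)) ⟩
    pivot * (pivot ^ n * detℤ M)
      ≡˘⟨ ℤ.*-assoc pivot (pivot ^ n) (detℤ M) ⟩
    pivot ^ suc n * detℤ M
      ∎
    where
    c : Fin (suc m)
    c = suc (f zero)
    Q : Matrix (suc m)
    Q = eliminateColumns (f ∘ suc)
    column : ∀ i → eliminatedColumn (f zero) i ≡ pivot * Q i c + - M zero c * Q i zero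
    column i = begin
      pivot * M i c - M zero c * M i zero
        ≡⟨ cong (λ t → pivot * M i c + t) (neg-distribˡ-* (M zero c) (M i zero)) ⟩
      pivot * M i c + - M zero c * M i zero
        ≡˘⟨ cong₂ (λ a z → pivot * a + - M zero c * z)
                  (eliminateColumns-untouched (f ∘ suc) (tail≢head f f-inj) i) (eliminateColumns-zero (f ∘ suc) i) ⟩
      pivot * Q i c + - M zero c * Q i zero
        ∎

  det-eliminate : detℤ eliminate ≡ pivot ^ m * detℤ M
  det-eliminate = trans (detℤ-cong eliminate-all) (det-eliminateColumns id id)
    where
    eliminate-all : ∀ i j → eliminate i j ≡ eliminateColumns id i j
    eliminate-all i zero    = sym (eliminateColumns-zero id i)
    eliminate-all i (suc j) = sym (eliminateColumns-touched id id j i)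

  det-eliminate-condense : detℤ eliminate ≡ pivot * detℤ condense
  det-eliminate-condense = begin
    1ℤ * (pivot * detℤ condense) + ∑[ j < m ] laplaceTerm eliminate (suc j)
      ≡⟨ cong₂ _+_ (*-identityˡ (pivot * detℤ condense)) (trans (sum-cong-≗ first-row-vanishes) (sum-replicate-zero m)) ⟩
    pivot * detℤ condense + 0ℤ
      ≡⟨ +-identityʳ _ ⟩
    pivot * detℤ condense
      ∎
    where
    first-row-vanishes : ∀ j → laplaceTerm eliminate (suc j) ≡ 0ℤ
    first-row-vanishes j = cancel (alt (toℕ (suc j))) pivot (M zero (suc j)) (detℤ (minor eliminate (suc j)))
      where
      cancel : ∀ s p x d → s * ((p * x - x * p) * d) ≡ 0ℤ
      cancel = solve-∀

  chio : pivot ^ m * detℤ M ≡ pivot * detℤ condense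
  chio = trans (sym det-eliminate) det-eliminate-condense

*-pos : ∀ {i j} → 0ℤ ℤ.< i → 0ℤ ℤ.< j → 0ℤ ℤ.< i * j
*-pos {i} {j} 0<i 0<j = subst (ℤ._< i * j) (*-zeroʳ i) (ℤ.*-monoˡ-<-pos i {{ℤ.positive 0<i}} 0<j)

*-nonNeg : ∀ {i j} → 0ℤ ℤ.≤ i → 0ℤ ℤ.≤ j → 0ℤ ℤ.≤ i * j
*-nonNeg {i} {j} 0≤i 0≤j = subst (ℤ._≤ i * j) (*-zeroʳ i) (ℤ.*-monoˡ-≤-nonNeg i {{ℤ.nonNegative 0≤i}} 0≤j)

^-nonNeg : ∀ {i} n → 0ℤ ℤ.≤ i → 0ℤ ℤ.≤ i ^ n
^-nonNeg zero    _   = +≤+ z≤n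
^-nonNeg (suc n) 0≤i = *-nonNeg 0≤i (^-nonNeg n 0≤i)

*-cancelˡ-pos : ∀ {i j} → 0ℤ ℤ.≤ i → 0ℤ ℤ.< i * j → 0ℤ ℤ.< j
*-cancelˡ-pos {i} {j} 0≤i 0<ij =
  ℤ.*-cancelˡ-<-nonNeg i {{ℤ.nonNegative 0≤i}} (subst (ℤ._< i * j) (sym (*-zeroʳ i)) 0<ij)

IsZMatrix : ∀ {m} → Matrix m → Set
IsZMatrix M = ∀ i j → i ≢ j → M i j ℤ.≤ 0ℤ

HasPositiveRowSums : ∀ {m} → Matrix m → Set
HasPositiveRowSums M = ∀ i → 0ℤ ℤ.< sum (M i)

module _ {m} {M : Matrix (suc m)} (M-Z : IsZMatrix M) (M-rows : HasPositiveRowSums M) where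

  pivot-positive : 0ℤ ℤ.< pivot M
  pivot-positive = ℤ.<-≤-trans (M-rows zero) (subst (sum (M zero) ℤ.≤_) (+-identityʳ (pivot M))
    (ℤ.+-monoʳ-≤ (pivot M) (sum-nonPos (M zero ∘ suc) λ j → M-Z zero (suc j) λ ())))

  condense-isZMatrix : IsZMatrix (condense M)
  condense-isZMatrix i l i≢l = subst (ℤ._≤ 0ℤ) (sym (as-negation (pivot M) a b w)) (ℤ.neg-mono-≤ 0≤products)
    where
    a b w : ℤ
    a = M (suc i) (suc l)
    b = M zero (suc l)
    w = M (suc i) zero
    0≤products : 0ℤ ℤ.≤ pivot M * - a + - b * - w
    0≤products = ℤ.+-mono-≤
      (*-nonNeg (ℤ.<⇒≤ pivot-positive) (ℤ.neg-mono-≤ (M-Z (suc i) (suc l) (i≢l ∘ suc-injective))))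
      (*-nonNeg (ℤ.neg-mono-≤ (M-Z zero (suc l) λ ())) (ℤ.neg-mono-≤ (M-Z (suc i) zero λ ())))
    as-negation : ∀ p a b w → p * a - b * w ≡ - (p * - a + - b * - w)
    as-negation = solve-∀

  condense-rowSum : ∀ i → sum (condense M i) ≡ pivot M * sum (M (suc i)) + - M (suc i) zero * sum (M zero)
  condense-rowSum i = begin
    ∑[ l < m ] (p * a l - b l * w)
      ≡⟨ ∑-distrib-+ (λ l → p * a l) (λ l → - (b l * w)) ⟩
    ∑[ l < m ] (p * a l) + ∑[ l < m ] (- (b l * w))
      ≡˘⟨ cong₂ _+_ (*-distribˡ-sum p a) (trans (cong -_ (*-distribʳ-sum w b)) (sym (sum-neg (λ l → b l * w)))) ⟩
    p * sum a + - (sum b * w)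
      ≡⟨ regroup p (sum a) (sum b) w ⟩
    p * (w + sum a) + - w * (p + sum b)
      ∎
    where
    p w : ℤ
    p = pivot M
    w = M (suc i) zero
    a b : Fin m → ℤ
    a l = M (suc i) (suc l)
    b l = M zero (suc l)
    regroup : ∀ p A B w → p * A + - (B * w) ≡ p * (w + A) + - w * (p + B)
    regroup = solve-∀

  condense-hasPositiveRowSums : HasPositiveRowSums (condense M)
  condense-hasPositiveRowSums i = subst (0ℤ ℤ.<_) (sym (condense-rowSum i))
    (ℤ.+-mono-<-≤ (*-pos pivot-positive (M-rows (suc i)))
                  (*-nonNeg (ℤ.neg-mono-≤ (M-Z (suc i) zero λ ())) (ℤ.<⇒≤ (M-rows zero))))

det-positive : ∀ {m} (M : Matrix m) → IsZMatrix M → HasPositiveRowSums M → 0ℤ ℤ.< detℤ M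
det-positive {zero}  M _   _      = +<+ (s≤s z≤n)
det-positive {suc m} M M-Z M-rows =
  *-cancelˡ-pos (^-nonNeg m (ℤ.<⇒≤ (pivot-positive M-Z M-rows)))
    (subst (0ℤ ℤ.<_) (sym (chio M))
      (*-pos (pivot-positive M-Z M-rows)
             (det-positive (condense M) (condense-isZMatrix M-Z M-rows) (condense-hasPositiveRowSums M-Z M-rows))))

regular-not-isospectral : ∀ {m} (A B : Matrix (suc m)) {r s : ℕ} → (∀ i j → 0ℤ ℤ.≤ A i j) →
  (∀ i → sum (A i) ≡ + r) → (∀ i → sum (B i) ≡ + s) → r ℕ.< s → ¬ Isospectral A B
regular-not-isospectral A B {r} {s} A≥0 A-rows B-rows r<s iso =
  ℤ.<-irrefl (sym B-root) (subst (0ℤ ℤ.<_) (eval-cong-coeff x (charPoly A) (charPoly B) iso) A-nonroot)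
  where
  x : ℤ
  x = + s
  xI-A-isZMatrix : IsZMatrix (charMatrix x A)
  xI-A-isZMatrix i j i≢j rewrite dec-false (i ≟ j) i≢j =
    subst (ℤ._≤ 0ℤ) (sym (+-identityˡ (- A i j))) (ℤ.neg-mono-≤ (A≥0 i j))
  xI-A-hasPositiveRowSums : HasPositiveRowSums (charMatrix x A)
  xI-A-hasPositiveRowSums i = subst (0ℤ ℤ.<_) (sym (trans (charMatrix-rowSum x A i) (cong (λ t → x - t) (A-rows i))))
    (subst (ℤ._< x - + r) (ℤ.+-inverseʳ (+ r)) (ℤ.+-monoˡ-< (- + r) (+<+ r<s)))
  A-nonroot : 0ℤ ℤ.< eval x (charPoly A)
  A-nonroot = subst (0ℤ ℤ.<_) (sym (eval-charPoly x A))
    (det-positive (charMatrix x A) xI-A-isZMatrix xI-A-hasPositiveRowSums)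
  B-root : eval x (charPoly B) ≡ 0ℤ
  B-root = trans (eval-charPoly x B) (det-zero-row-sums (charMatrix x B) λ i →
    trans (charMatrix-rowSum x B i) (trans (cong (λ t → x - t) (B-rows i)) (ℤ.+-inverseʳ x)))

-- The graphs MX*(G;S,T)

indicator : Bool → ℤ
indicator b = if b then 1ℤ else 0ℤ

indicator-nonNeg : ∀ b → 0ℤ ℤ.≤ indicator b
indicator-nonNeg true  = +≤+ z≤n
indicator-nonNeg false = +≤+ z≤n

sum-indicator : ∀ {n} (X : Subset n) → ∑[ x < n ] indicator (lookup X x) ≡ + ∣ X ∣
sum-indicator []          = refl
sum-indicator (true ∷ X)  = cong (λ t → 1ℤ + t) (sum-indicator X)
sum-indicator (false ∷ X) = trans (+-identityˡ _) (sum-indicator X)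

module _ {n} (G : FinGroup n) where
  open FinGroup G

  asGroup : Group 0ℓ 0ℓ
  asGroup = record { isGroup = isGroup }

  open import Algebra.Properties.Group asGroup using (//-rightDividesˡ; //-rightDividesʳ)

  sum-indicator-∙ʳ : ∀ (X : Subset n) c → ∑[ g < n ] indicator (lookup X (g ∙ c)) ≡ + ∣ X ∣
  sum-indicator-∙ʳ X c =
    trans (sym (sum-permute (indicator ∘ lookup X) (permutation (_∙ c) (_∙ c ⁻¹) (//-rightDividesˡ c) (//-rightDividesʳ c))))
          (sum-indicator X)

  row-degree : ∀ (S T : Subset n) (i : Fin 2) c →
    ∑[ j < 2 ] ∑[ g < n ] indicator (if does (i ≟ j) then lookup S (g ∙ c) else lookup T (g ∙ c))
      ≡ + (∣ S ∣ ℕ.+ ∣ T ∣)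
  row-degree S T zero       c = cong₂ _+_ (sum-indicator-∙ʳ S c) (trans (+-identityʳ _) (sum-indicator-∙ʳ T c))
  row-degree S T (suc zero) c =
    trans (cong₂ _+_ (sum-indicator-∙ʳ T c) (trans (+-identityʳ _) (sum-indicator-∙ʳ S c)))
          (cong +_ (ℕ.+-comm ∣ T ∣ ∣ S ∣))

  mx-degree : ∀ k S T u → sum (MX G k S T u) ≡ + (∣ S ∣ ℕ.+ ∣ T ∣)
  mx-degree k S T u = begin
    sum (MX G k S T u)
      ≡˘⟨ sum-combine 2 n (MX G k S T u) ⟩
    ∑[ j < 2 ] ∑[ g < n ] MX G k S T u (combine j g)
      ≡⟨ sum-cong-≗ (λ j → sum-cong-≗ λ g → cong (indicator ∘ MXEdge G k S T (remQuot n u)) (remQuot-combine j g)) ⟩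
    ∑[ j < 2 ] ∑[ g < n ] indicator (MXEdge G k S T (remQuot n u) (j , g))
      ≡⟨ edges k ⟩
    + (∣ S ∣ ℕ.+ ∣ T ∣)
      ∎
    where
    edges : ∀ k → ∑[ j < 2 ] ∑[ g < n ] indicator (MXEdge G k S T (remQuot n u) (j , g)) ≡ + (∣ S ∣ ℕ.+ ∣ T ∣)
    edges minus = row-degree S T (proj₁ (remQuot n u)) (proj₂ (remQuot n u) ⁻¹)
    edges plus  = row-degree S T (proj₁ (remQuot n u)) (proj₂ (remQuot n u))

mx-not-isospectral : ∀ k {n} (G : FinGroup n) S T T′ → ∣ T ∣ ℕ.< ∣ T′ ∣ → ¬ Isospectral (MX G k S T) (MX G k S T′)
mx-not-isospectral k {zero}  G S T T′ _ with FinGroup.ε G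
... | ()
mx-not-isospectral k {suc n} G S T T′ T<T′ =
  regular-not-isospectral (MX G k S T) (MX G k S T′) (λ u v → indicator-nonNeg _)
    (mx-degree G k S T) (mx-degree G k S T′) (ℕ.+-monoʳ-< ∣ S ∣ T<T′)

proposition6p1 : (k : Kind) {n : ℕ} (G : FinGroup n) (S : Subset n) →
    2 ≤ ∣ S ∣ →
    (¬ Isospectral (MX G k S ⁅ FinGroup.ε G ⁆) (MX G k S S))
    × (¬ Isospectral (MX G k S ⁅ FinGroup.ε G ⁆) (MX G k S (S ∪ ⁅ FinGroup.ε G ⁆)))
    × (FinGroup.ε G ∉ S →
        ¬ Isospectral (MX G k S S) (MX G k S (S ∪ ⁅ FinGroup.ε G ⁆)))
proposition6p1 k G S 2≤∣S∣ =
    mx-not-isospectral k G S ⁅ e ⁆ S ∣⁅e⁆∣<∣S∣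
  , mx-not-isospectral k G S ⁅ e ⁆ (S ∪ ⁅ e ⁆) (ℕ.<-≤-trans ∣⁅e⁆∣<∣S∣ (∣p∣≤∣p∪q∣ S ⁅ e ⁆))
  , λ e∉S → mx-not-isospectral k G S S (S ∪ ⁅ e ⁆) (p⊂q⇒∣p∣<∣q∣ (p⊆p∪q ⁅ e ⁆ , e , q⊆p∪q S ⁅ e ⁆ (x∈⁅x⁆ e) , e∉S))
  where
  e : Fin _
  e = FinGroup.ε G
  ∣⁅e⁆∣<∣S∣ : ∣ ⁅ e ⁆ ∣ ℕ.< ∣ S ∣
  ∣⁅e⁆∣<∣S∣ = subst (ℕ._< ∣ S ∣) (sym (∣⁅x⁆∣≡1 e)) 2≤∣S∣
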